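{- Let $s\ge 2$ be an integer, and let $a,b$ be non-negative integers with $a-b=s$ and $b<s$. Let $(P,\mathfrak{B})$ be a strongly resolvable $2$-$(s^3,s^2,s+1)$ design, i.e. a quasi-symmetric design with $|B_1\cap B_2|\in\{0,s\}$ for all distinct $B_1,B_2\in\mathfrak{B}$. Then there is no non-empty subset $S\subseteq P$ such that $|S\cap B|\in\{a,b\}$ for every $B\in\mathfrak{B}$.
   Context: A $2$-$(v,k,\lambda)$ design $(P,\mathfrak{B})$ consists of a set $P$ of $v$ points and a collection $\mathfrak{B}$ of $k$-subsets (blocks) such that every pair of distinct points lies in exactly $\lambda$ blocks. It is quasi-symmetric if the intersection of two distinct blocks takes only two sizes. It is strongly resolvable if its block graph (blocks adjacent when they meet in the larger intersection size... equivalently here) is a complete multipartite graph; in particular the blocks are partitioned into parallel classes, each class partitioning $P$ into disjoint blocks (here two blocks meet in $0$ points iff they lie in the same parallel class). An example is the design of points and planes of the affine space $AG(3,s)$ for prime power $s$. -}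

module Defs where

open import Data.Nat using (ℕ; _^_)
open import Data.Bool using (_∧_)
open import Data.Fin using (Fin)
open import Data.Fin.Subset using (Subset; ∣_∣; _∩_)
open import Data.Vec using (tabulate; lookup)
open import Data.Sum using (_⊎_)
open import Relation.Binary.PropositionalEquality using (_≡_; _≢_)

-- A block family on the point set Fin v: b blocks, block i is the subset B i.
-- (Blocks are indexed, so repeated blocks are allowed a priori.)

blocksThrough : ∀ {v b} → (Fin b → Subset v) → Fin v → Fin v → Subset b
blocksThrough B x y = tabulate (λ i → lookup (B i) x ∧ lookup (B i) y)

Is2Design : ∀ {b} (v k λ′ : ℕ) → (Fin b → Subset v) → Set
Is2Design {b} v k λ′ B =
  ((i : Fin b) → ∣ B i ∣ ≡ k) ×′
  ((x y : Fin v) → x ≢ y → ∣ blocksThrough B x y ∣ ≡ λ′)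
  where
  open import Data.Product using () renaming (_×_ to _×′_)

IsSRDesign : ∀ {b} (s : ℕ) → (Fin b → Subset (s ^ 3)) → Set
IsSRDesign {b} s B =
  Is2Design (s ^ 3) (s ^ 2) (ℕ.suc s) B ×′
  ((i j : Fin b) → i ≢ j → (∣ B i ∩ B j ∣ ≡ 0) ⊎ (∣ B i ∩ B j ∣ ≡ s))
  where
  open import Data.Product using () renaming (_×_ to _×′_)

-- With m = |S|, f i = |S ∩ Bᵢ| and r₀ = s² + s + 1:
--   * every point lies on r₀ blocks and there are s r₀ blocks (the standard
--     2-design identities), so Σᵢ fᵢ = m r₀;
--   * for a point p ∈ S, counting pairs (q, B) with q ∈ S and p, q ∈ B gives
--     Σ_{B ∋ p} |S ∩ B| = r₀ + (m − 1)(s + 1) = s² + m (s + 1).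
-- Reducing modulo s (every fᵢ ≡ b): the first identity gives s ∣ m r₀, hence
-- s ∣ m since s and r₀ are coprime; the second then gives s ∣ r₀ b, so b = 0.
-- Then fᵢ ∈ {0, s}, so Σ fᵢ² = s Σ fᵢ = s m r₀, while the second identity
-- summed over S gives Σ fᵢ² = m (s² + m (s + 1)).  Hence s³ + s = m (s + 1),
-- impossible as s³ + s ≡ −2 (mod s + 1).
module Submission where

open import Defs
open import Data.Nat using (ℕ; _+_; _^_; _≤_; _<_)
open import Data.Fin using (Fin)
open import Data.Fin.Subset using (Subset; ∣_∣; _∩_; Nonempty)
open import Data.Product using (Σ; _×_)
open import Data.Sum using (_⊎_)
open import Relation.Nullary using (¬_)
open import Relation.Binary.PropositionalEquality using (_≡_)

open import Data.Nat using (zero; suc; _*_; NonZero; >-nonZero; z≤n; s≤s)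
open import Data.Nat.Properties
open import Data.Nat.Divisibility using (_∣_; divides; ∣m+n∣m⇒∣n; m∣m*n; >⇒∤)
open import Data.Nat.Solver using (module +-*-Solver)
open +-*-Solver using (solve; _:+_; _:*_; _:^_; _:=_; con)
open import Algebra.Properties.Semiring.Sum +-*-semiring
  using (sum; sum-syntax; sum-cong-≗; ∑-comm; sum-remove; *-distribˡ-sum; *-distribʳ-sum)
open import Data.Bool using (Bool; true; false; _∧_)
open import Data.Fin using (zero; suc; punchIn)
open import Data.Fin.Properties using (punchInᵢ≢i)
open import Data.Vec using ([]; _∷_; lookup)
open import Data.Vec.Properties using (lookup-zipWith; lookup∘tabulate; []=⇒lookup)
open import Data.Vec.Functional using (removeAt)
open import Data.Product using (∃-syntax; _,_; proj₁; proj₂)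
open import Data.Sum using (inj₁; inj₂)
import Data.Sum as Sum
open import Data.Empty using (⊥; ⊥-elim)
open import Relation.Binary.PropositionalEquality using (_≢_; refl; sym; trans; cong; cong₂; subst; module ≡-Reasoning)

open ≡-Reasoning

sum-const : ∀ n c → ∑[ i < n ] c ≡ n * c
sum-const zero    c = refl
sum-const (suc n) c = cong (c +_) (sum-const n c)

sum-except : ∀ {n} (t h : Fin n → ℕ) (q : Fin n) {c d : ℕ} →
             h q ≡ d → (∀ p → p ≢ q → h p ≡ c) →
             ∑[ p < n ] (t p * h p) + t q * c ≡ t q * d + sum t * c
sum-except {suc n} t h q {c} {d} hq≡d h≡c = begin
  sum th + t q * c                                ≡⟨ cong (_+ t q * c) (sum-remove {i = q} th) ⟩
  t q * h q + sum (removeAt th q) + t q * c       ≡⟨ cong₂ (λ x y → t q * x + y + t q * c) hq≡d others ⟩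
  t q * d + sum (removeAt t q) * c + t q * c      ≡⟨ regroup (t q * d) (sum (removeAt t q)) (t q) c ⟩
  t q * d + (t q + sum (removeAt t q)) * c        ≡⟨ cong (λ x → t q * d + x * c) (sym (sum-remove {i = q} t)) ⟩
  t q * d + sum t * c                             ∎
  where
  th : Fin (suc n) → ℕ
  th p = t p * h p
  others : sum (removeAt th q) ≡ sum (removeAt t q) * c
  others = trans (sum-cong-≗ (λ p → cong (t (punchIn q p) *_) (h≡c _ (punchInᵢ≢i q p))))
                 (sym (*-distribʳ-sum c (removeAt t q)))
  regroup : ∀ x y z c → x + y * c + z * c ≡ x + (z + y) * c
  regroup = solve 4 (λ x y z c → x :+ y :* c :+ z :* c := x :+ (z :+ y) :* c) refl

summand≤sum : ∀ {n} (f : Fin n → ℕ) i → f i ≤ sum f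
summand≤sum f zero    = m≤m+n (f zero) _
summand≤sum f (suc i) = ≤-trans (summand≤sum (λ j → f (suc j)) i) (m≤n+m _ (f zero))

sum-residue : ∀ {n} (s : ℕ) (f g : Fin n → ℕ) → (∀ i → ∃[ d ] f i ≡ g i + s * d) →
              ∃[ D ] sum f ≡ sum g + s * D
sum-residue {zero}  s f g _  = 0 , sym (*-zeroʳ s)
sum-residue {suc n} s f g fg with fg zero | sum-residue s (λ i → f (suc i)) (λ i → g (suc i)) (λ i → fg (suc i))
... | d , f₀ | D , fs = d + D , (begin
  f zero + sum (λ i → f (suc i))                   ≡⟨ cong₂ _+_ f₀ fs ⟩
  g zero + s * d + (sum (λ i → g (suc i)) + s * D) ≡⟨ regroup (g zero) (sum (λ i → g (suc i))) s d D ⟩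
  g zero + sum (λ i → g (suc i)) + s * (d + D)     ∎)
  where
  regroup : ∀ x y s d D → x + s * d + (y + s * D) ≡ x + y + s * (d + D)
  regroup = solve 5 (λ x y s d D → x :+ s :* d :+ (y :+ s :* D) := x :+ y :+ s :* (d :+ D)) refl

𝟙 : Bool → ℕ
𝟙 true  = 1
𝟙 false = 0

𝟙-∧ : ∀ x y → 𝟙 (x ∧ y) ≡ 𝟙 x * 𝟙 y
𝟙-∧ true  true  = refl
𝟙-∧ true  false = refl
𝟙-∧ false _     = refl

𝟙-idem : ∀ x → 𝟙 x * 𝟙 x ≡ 𝟙 x
𝟙-idem true  = refl
𝟙-idem false = refl

card-sum : ∀ {n} (X : Subset n) → ∣ X ∣ ≡ ∑[ p < n ] 𝟙 (lookup X p)
card-sum []          = refl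
card-sum (true  ∷ X) = cong suc (card-sum X)
card-sum (false ∷ X) = card-sum X

card-∩ : ∀ {n} (X Y : Subset n) → ∣ X ∩ Y ∣ ≡ ∑[ p < n ] (𝟙 (lookup X p) * 𝟙 (lookup Y p))
card-∩ X Y = trans (card-sum (X ∩ Y))
  (sum-cong-≗ (λ p → trans (cong 𝟙 (lookup-zipWith _∧_ p X Y)) (𝟙-∧ (lookup X p) (lookup Y p))))

module Incidence {v nb : ℕ} (B : Fin nb → Subset v) where

  inc : Fin nb → Fin v → ℕ
  inc i p = 𝟙 (lookup (B i) p)

  replication : Fin v → ℕ
  replication p = ∑[ i < nb ] inc i p

  weight : (Fin v → ℕ) → Fin nb → ℕ
  weight t i = ∑[ p < v ] (t p * inc i p)

  double-count : (g : Fin nb → ℕ) (t : Fin v → ℕ) →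
                 ∑[ i < nb ] (g i * weight t i) ≡ ∑[ p < v ] (t p * ∑[ i < nb ] (inc i p * g i))
  double-count g t = begin
    ∑[ i < nb ] (g i * weight t i)                      ≡⟨ sum-cong-≗ (λ i → *-distribˡ-sum (g i) (λ p → t p * inc i p)) ⟩
    ∑[ i < nb ] ∑[ p < v ] (g i * (t p * inc i p))      ≡⟨ ∑-comm (λ i p → g i * (t p * inc i p)) ⟩
    ∑[ p < v ] ∑[ i < nb ] (g i * (t p * inc i p))      ≡⟨ sum-cong-≗ (λ p → sum-cong-≗ (λ i → shuffle (g i) (t p) (inc i p))) ⟩
    ∑[ p < v ] ∑[ i < nb ] (t p * (inc i p * g i))      ≡⟨ sum-cong-≗ (λ p → *-distribˡ-sum (t p) (λ i → inc i p * g i)) ⟨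
    ∑[ p < v ] (t p * ∑[ i < nb ] (inc i p * g i))      ∎
    where
    shuffle : ∀ x y z → x * (y * z) ≡ y * (z * x)
    shuffle = solve 3 (λ x y z → x :* (y :* z) := y :* (z :* x)) refl

  sum-weights : (t : Fin v → ℕ) → ∑[ i < nb ] weight t i ≡ ∑[ p < v ] (t p * replication p)
  sum-weights t = begin
    ∑[ i < nb ] ∑[ p < v ] (t p * inc i p)   ≡⟨ ∑-comm (λ i p → t p * inc i p) ⟩
    ∑[ p < v ] ∑[ i < nb ] (t p * inc i p)   ≡⟨ sum-cong-≗ (λ p → *-distribˡ-sum (t p) (λ i → inc i p)) ⟨
    ∑[ p < v ] (t p * replication p)         ∎

  card-blocksThrough : ∀ p q → ∣ blocksThrough B p q ∣ ≡ ∑[ i < nb ] (inc i p * inc i q)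
  card-blocksThrough p q = trans (card-sum (blocksThrough B p q)) (sum-cong-≗ λ i →
    trans (cong 𝟙 (lookup∘tabulate (λ j → lookup (B j) p ∧ lookup (B j) q) i))
          (𝟙-∧ (lookup (B i) p) (lookup (B i) q)))

module Design {v k λ′ nb : ℕ} (B : Fin nb → Subset v) (design : Is2Design v k λ′ B) where

  open Incidence B

  block-size : ∀ i → ∑[ p < v ] inc i p ≡ k
  block-size i = trans (sym (card-sum (B i))) (proj₁ design i)

  pair-count : ∀ p q → p ≢ q → ∑[ i < nb ] (inc i p * inc i q) ≡ λ′
  pair-count p q p≢q = trans (sym (card-blocksThrough p q)) (proj₂ design p q p≢q)

  -- Blocks through a fixed point q, weighted by their t-weight:
  -- each other point p contributes t p · λ′, and q itself t q · r_q.
  weighted-pair-count : (t : Fin v → ℕ) (q : Fin v) →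
    ∑[ i < nb ] (inc i q * weight t i) + t q * λ′ ≡ t q * replication q + sum t * λ′
  weighted-pair-count t q = begin
    ∑[ i < nb ] (inc i q * weight t i) + t q * λ′                 ≡⟨ cong (_+ t q * λ′) (double-count (λ i → inc i q) t) ⟩
    ∑[ p < v ] (t p * ∑[ i < nb ] (inc i p * inc i q)) + t q * λ′ ≡⟨ sum-except t (λ p → ∑[ i < nb ] (inc i p * inc i q)) q diagonal (λ p → pair-count p q) ⟩
    t q * replication q + sum t * λ′                              ∎
    where
    diagonal : ∑[ i < nb ] (inc i q * inc i q) ≡ replication q
    diagonal = sum-cong-≗ (λ i → 𝟙-idem (lookup (B i) q))

  -- The classical relation  r (k - 1) = λ′ (v - 1)  for the replication number.
  replication-equation : ∀ q → replication q * k + λ′ ≡ replication q + v * λ′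
  replication-equation q = begin
    replication q * k + λ′                                   ≡⟨ cong₂ _+_ (*-distribʳ-sum k (λ i → inc i q)) (sym (*-identityˡ λ′)) ⟩
    ∑[ i < nb ] (inc i q * k) + 1 * λ′                       ≡⟨ cong (_+ 1 * λ′) (sum-cong-≗ (λ i → cong (inc i q *_) (sym (unit-weight i)))) ⟩
    ∑[ i < nb ] (inc i q * weight (λ _ → 1) i) + 1 * λ′      ≡⟨ weighted-pair-count (λ _ → 1) q ⟩
    1 * replication q + sum {v} (λ _ → 1) * λ′               ≡⟨ cong₂ (λ x y → x + y * λ′) (*-identityˡ _) (trans (sum-const v 1) (*-identityʳ v)) ⟩
    replication q + v * λ′                                   ∎
    where
    unit-weight : ∀ i → weight (λ _ → 1) i ≡ k
    unit-weight i = trans (sum-cong-≗ (λ p → *-identityˡ (inc i p))) (block-size i)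

  block-count : ∀ r → (∀ p → replication p ≡ r) → nb * k ≡ v * r
  block-count r rep = begin
    nb * k                         ≡⟨ sum-const nb k ⟨
    ∑[ i < nb ] k                  ≡⟨ sum-cong-≗ block-size ⟨
    ∑[ i < nb ] ∑[ p < v ] inc i p ≡⟨ ∑-comm inc ⟩
    ∑[ p < v ] replication p       ≡⟨ sum-cong-≗ rep ⟩
    ∑[ p < v ] r                   ≡⟨ sum-const v r ⟩
    v * r                          ∎

-- The replication number (s³ − 1)/(s − 1) of a 2-(s³, s², s+1) design.
r₀ : ℕ → ℕ
r₀ s = s ^ 2 + s + 1

-- For c ≥ 2 the map x ↦ x·c − x is injective (stated without subtraction).
affine-injective : ∀ {c d X x y} → 2 ≤ c → x * c + d ≡ x + X → y * c + d ≡ y + X → x ≡ y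
affine-injective {suc (suc c)} {d} {X} {x} {y} (s≤s (s≤s z≤n)) ex ey =
  *-cancelʳ-≡ x y (suc c) (+-cancelʳ-≡ d _ _ (trans (excess ex) (sym (excess ey))))
  where
  excess : ∀ {z} → z * suc (suc c) + d ≡ z + X → z * suc c + d ≡ X
  excess {z} e = +-cancelˡ-≡ z _ _ (begin
    z + (z * suc c + d)    ≡⟨ +-assoc z (z * suc c) d ⟨
    z + z * suc c + d      ≡⟨ cong (_+ d) (*-suc z (suc c)) ⟨
    z * suc (suc c) + d    ≡⟨ e ⟩
    z + X                  ∎)

replication-number : ∀ {s r} → 2 ≤ s → r * s ^ 2 + suc s ≡ r + s ^ 3 * suc s → r ≡ r₀ s
replication-number {s} 2≤s e = affine-injective (square≥2 2≤s) e (r₀-is-solution s)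
  where
  square≥2 : ∀ {s} → 2 ≤ s → 2 ≤ s ^ 2
  square≥2 (s≤s (s≤s z≤n)) = s≤s (s≤s z≤n)
  r₀-is-solution : ∀ n → (n ^ 2 + n + 1) * n ^ 2 + (1 + n) ≡ (n ^ 2 + n + 1) + n ^ 3 * (1 + n)
  r₀-is-solution = solve 1 (λ n → (n :^ 2 :+ n :+ con 1) :* n :^ 2 :+ (con 1 :+ n) := (n :^ 2 :+ n :+ con 1) :+ n :^ 3 :* (con 1 :+ n)) refl

-- s is coprime to r₀ s = s(s+1) + 1.
∣r₀*⇒∣ : ∀ s m → s ∣ r₀ s * m → s ∣ m
∣r₀*⇒∣ s m s∣r₀m = ∣m+n∣m⇒∣n (subst (s ∣_) (expand s m) s∣r₀m) (m∣m*n ((s + 1) * m))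
  where
  expand : ∀ s m → (s ^ 2 + s + 1) * m ≡ s * ((s + 1) * m) + m
  expand = solve 2 (λ s m → (s :^ 2 :+ s :+ con 1) :* m := s :* ((s :+ con 1) :* m) :+ m) refl

square-0-or-s : ∀ {s x} → x ≡ s ⊎ x ≡ 0 → x * x ≡ s * x
square-0-or-s     (inj₁ refl) = refl
square-0-or-s {s} (inj₂ refl) = sym (*-zeroʳ s)

divisor-below : ∀ {s b} → s ∣ b → b < s → b ≡ 0
divisor-below {b = zero}  _   _   = refl
divisor-below {b = suc _} s∣b b<s = ⊥-elim (>⇒∤ b<s s∣b)

-- s+1 never divides s³ + s when s ≥ 2, since s³ + s ≡ −2 (mod s+1).
no-multiple : ∀ {s m} → 2 ≤ s → s ^ 3 + s ≢ m * suc s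
no-multiple {suc (suc k)} {m} (s≤s (s≤s z≤n)) e =
  >⇒∤ (s≤s (s≤s (s≤s z≤n))) (∣m+n∣m⇒∣n (divides (k * k + 3 * k + 4) (factor k)) (divides m e))
  where
  factor : ∀ k → (2 + k) ^ 3 + (2 + k) + 2 ≡ (k * k + 3 * k + 4) * (3 + k)
  factor = solve 1 (λ k → (con 2 :+ k) :^ 3 :+ (con 2 :+ k) :+ con 2 := (k :* k :+ con 3 :* k :+ con 4) :* (con 3 :+ k)) refl

module PointSet (s : ℕ) (2≤s : 2 ≤ s) {nb : ℕ} (B : Fin nb → Subset (s ^ 3))
                (design : Is2Design (s ^ 3) (s ^ 2) (suc s) B) (S : Subset (s ^ 3)) where

  open Incidence B
  open Design B design

  t : Fin (s ^ 3) → ℕ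
  t p = 𝟙 (lookup S p)

  m : ℕ
  m = sum t

  f : Fin nb → ℕ
  f = weight t

  card-S∩B : ∀ i → ∣ S ∩ B i ∣ ≡ f i
  card-S∩B i = card-∩ S (B i)

  replication-r₀ : ∀ p → replication p ≡ r₀ s
  replication-r₀ p = replication-number 2≤s (replication-equation p)

  block-number : nb ≡ s * r₀ s
  block-number = *-cancelʳ-≡ nb (s * r₀ s) (s ^ 2) {{m^n≢0 s 2 {{>-nonZero (≤-trans (s≤s z≤n) 2≤s)}}}}
    (trans (block-count (r₀ s) replication-r₀) (regroup s (r₀ s)))
    where
    regroup : ∀ s r → s ^ 3 * r ≡ s * r * s ^ 2
    regroup = solve 2 (λ s r → s :^ 3 :* r := s :* r :* s :^ 2) refl

  sum-f : sum f ≡ m * r₀ s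
  sum-f = trans (sum-weights t)
    (trans (sum-cong-≗ (λ p → cong (t p *_) (replication-r₀ p))) (sym (*-distribʳ-sum (r₀ s) t)))

  point-sum : ∀ p → lookup S p ≡ true → ∑[ i < nb ] (inc i p * f i) ≡ s ^ 2 + m * suc s
  point-sum p p∈S = +-cancelʳ-≡ (suc s) _ _ (begin
    Σp + suc s                        ≡⟨ cong (λ x → Σp + x) (*-identityˡ (suc s)) ⟨
    Σp + 1 * suc s                    ≡⟨ cong (λ x → Σp + x * suc s) tp≡1 ⟨
    Σp + t p * suc s                  ≡⟨ weighted-pair-count t p ⟩
    t p * replication p + m * suc s   ≡⟨ cong₂ (λ x y → x * y + m * suc s) tp≡1 (replication-r₀ p) ⟩
    1 * r₀ s + m * suc s              ≡⟨ regroup s m ⟩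
    s ^ 2 + m * suc s + suc s         ∎)
    where
    Σp : ℕ
    Σp = ∑[ i < nb ] (inc i p * f i)
    tp≡1 : t p ≡ 1
    tp≡1 = cong 𝟙 p∈S
    regroup : ∀ s m → 1 * (s ^ 2 + s + 1) + m * (1 + s) ≡ s ^ 2 + m * (1 + s) + (1 + s)
    regroup = solve 2 (λ s m → con 1 :* (s :^ 2 :+ s :+ con 1) :+ m :* (con 1 :+ s) := s :^ 2 :+ m :* (con 1 :+ s) :+ (con 1 :+ s)) refl

  sum-point-sums : ∑[ p < s ^ 3 ] (t p * ∑[ i < nb ] (inc i p * f i)) ≡ m * (s ^ 2 + m * suc s)
  sum-point-sums = trans (sum-cong-≗ (λ p → 𝟙-guard (lookup S p) (point-sum p)))
                         (sym (*-distribʳ-sum (s ^ 2 + m * suc s) t))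
    where
    𝟙-guard : ∀ x {y z} → (x ≡ true → y ≡ z) → 𝟙 x * y ≡ 𝟙 x * z
    𝟙-guard true  y≡z = cong (1 *_) (y≡z refl)
    𝟙-guard false _   = refl

  module TwoValues (b : ℕ) (values : ∀ i → f i ≡ b + s ⊎ f i ≡ b) where

    residue : ∀ i → ∃[ d ] f i ≡ b + s * d
    residue i with values i
    ... | inj₁ e = 1 , trans e (cong (b +_) (sym (*-identityʳ s)))
    ... | inj₂ e = 0 , trans e (sym (trans (cong (b +_) (*-zeroʳ s)) (+-identityʳ b)))

    -- Summing f modulo s:  m r₀ = Σ f ≡ nb·b = s r₀ b, so s ∣ m.
    s∣m : s ∣ m
    s∣m with sum-residue s f (λ _ → b) residue
    ... | D , Σf = ∣r₀*⇒∣ s m (divides (r₀ s * b + D) (begin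
      r₀ s * m              ≡⟨ *-comm (r₀ s) m ⟩
      m * r₀ s              ≡⟨ sum-f ⟨
      sum f                 ≡⟨ Σf ⟩
      ∑[ i < nb ] b + s * D ≡⟨ cong (_+ s * D) (trans (sum-const nb b) (cong (_* b) block-number)) ⟩
      s * r₀ s * b + s * D  ≡⟨ regroup s (r₀ s) b D ⟩
      (r₀ s * b + D) * s    ∎))
      where
      regroup : ∀ s r b D → s * r * b + s * D ≡ (r * b + D) * s
      regroup = solve 4 (λ s r b D → s :* r :* b :+ s :* D := (r :* b :+ D) :* s) refl

    weighted-residue : ∀ p i → ∃[ d ] inc i p * f i ≡ inc i p * b + s * d
    weighted-residue p i with residue i
    ... | d , e = inc i p * d , trans (cong (inc i p *_) e) (distribute (inc i p) b s d)
      where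
      distribute : ∀ w b s d → w * (b + s * d) ≡ w * b + s * (w * d)
      distribute = solve 4 (λ w b s d → w :* (b :+ s :* d) := w :* b :+ s :* (w :* d)) refl

    -- Summing f over the blocks through a point of S modulo s:
    -- r₀ b ≡ s² + m(s+1) ≡ 0, so s ∣ b, whence b = 0.
    b≡0 : ∀ p → lookup S p ≡ true → b < s → b ≡ 0
    b≡0 p p∈S b<s with sum-residue s (λ i → inc i p * f i) (λ i → inc i p * b) (weighted-residue p)
    ... | Y , Σp = divisor-below (∣r₀*⇒∣ s b (∣m+n∣m⇒∣n s∣sY+r₀b (m∣m*n Y))) b<s
      where
      s∣sY+r₀b : s ∣ s * Y + r₀ s * b
      s∣sY+r₀b with s∣m
      ... | divides q m≡qs = divides (s + q * suc s) (begin
        s * Y + r₀ s * b                       ≡⟨ +-comm (s * Y) (r₀ s * b) ⟩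
        r₀ s * b + s * Y                       ≡⟨ cong (λ x → x * b + s * Y) (replication-r₀ p) ⟨
        replication p * b + s * Y              ≡⟨ cong (_+ s * Y) (*-distribʳ-sum b (λ i → inc i p)) ⟩
        ∑[ i < nb ] (inc i p * b) + s * Y      ≡⟨ Σp ⟨
        ∑[ i < nb ] (inc i p * f i)            ≡⟨ point-sum p p∈S ⟩
        s ^ 2 + m * suc s                      ≡⟨ cong (λ x → s ^ 2 + x * suc s) m≡qs ⟩
        s ^ 2 + q * s * suc s                  ≡⟨ regroup s q ⟩
        (s + q * suc s) * s                    ∎)
        where
        regroup : ∀ s q → s ^ 2 + q * s * (1 + s) ≡ (s + q * (1 + s)) * s
        regroup = solve 2 (λ s q → s :^ 2 :+ q :* s :* (con 1 :+ s) := (s :+ q :* (con 1 :+ s)) :* s) refl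

    -- With b = 0 every f i is 0 or s, so Σ f² = s Σ f = s m r₀; counting Σ f²
    -- through the points of S gives m (s² + m(s+1)), and comparing the two
    -- yields s³ + s = m (s+1), which is impossible.
    no-point : ∀ p → lookup S p ≡ true → b < s → ⊥
    no-point p p∈S b<s =
      no-multiple {m = m} 2≤s (+-cancelˡ-≡ (s ^ 2) (s ^ 3 + s) (m * suc s) (trans (regroup s) per-point))
      where
      zero-or-s : ∀ i → f i ≡ s ⊎ f i ≡ 0
      zero-or-s i = Sum.map (λ e → trans e (cong (_+ s) (b≡0 p p∈S b<s))) (λ e → trans e (b≡0 p p∈S b<s)) (values i)
      m≢0 : NonZero m
      m≢0 = >-nonZero (≤-trans (≤-reflexive (sym (cong 𝟙 p∈S))) (summand≤sum t p))
      squares : m * (s * r₀ s) ≡ m * (s ^ 2 + m * suc s)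
      squares = begin
        m * (s * r₀ s)                                        ≡⟨ *-comm m _ ⟩
        s * r₀ s * m                                          ≡⟨ *-assoc s (r₀ s) m ⟩
        s * (r₀ s * m)                                        ≡⟨ cong (s *_) (trans (*-comm (r₀ s) m) (sym sum-f)) ⟩
        s * sum f                                             ≡⟨ *-distribˡ-sum s f ⟩
        ∑[ i < nb ] (s * f i)                                 ≡⟨ sum-cong-≗ (λ i → square-0-or-s (zero-or-s i)) ⟨
        ∑[ i < nb ] (f i * weight t i)                        ≡⟨ double-count f t ⟩
        ∑[ p < s ^ 3 ] (t p * ∑[ i < nb ] (inc i p * f i))    ≡⟨ sum-point-sums ⟩
        m * (s ^ 2 + m * suc s)                               ∎
      per-point : s * r₀ s ≡ s ^ 2 + m * suc s
      per-point = *-cancelˡ-≡ _ _ m {{m≢0}} squares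
      regroup : ∀ s → s ^ 2 + (s ^ 3 + s) ≡ s * (s ^ 2 + s + 1)
      regroup = solve 1 (λ s → s :^ 2 :+ (s :^ 3 :+ s) := s :* (s :^ 2 :+ s :+ con 1)) refl

-- Lemma 3.8.  No nonempty point set of a strongly resolvable
-- 2-(s³, s², s+1) design meets every block in a = b + s or b < s points.
lemma3p8 : (s a b : ℕ) → 2 ≤ s → a ≡ b + s → b < s →
           (nb : ℕ) (B : Fin nb → Subset (s ^ 3)) → IsSRDesign s B →
           ¬ (Σ (Subset (s ^ 3)) λ S →
                Nonempty S ×
                ((i : Fin nb) → (∣ S ∩ B i ∣ ≡ a) ⊎ (∣ S ∩ B i ∣ ≡ b)))
lemma3p8 s a b 2≤s refl b<s nb B (design , _) (S , (p , p∈S) , sizes) =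
  no-point p ([]=⇒lookup p∈S) b<s
  where
  open PointSet s 2≤s B design S
  values : ∀ i → f i ≡ b + s ⊎ f i ≡ b
  values i = Sum.map (trans (sym (card-S∩B i))) (trans (sym (card-S∩B i))) (sizes i)
  open TwoValues b values
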